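{- Let $k\geq 1$ and let $G=(V,E)$ be a $2k$-ordered simple graph with at least $2k$ vertices. If $1\leq s\leq k$, then there is no subset $V_1\subseteq V$ with $|V_1|=s$, $|V\setminus (N(V_1)\cup V_1)|\geq s$, and $|N(V_1)|<2s$.
   Context: For $S\subseteq V$, $N(S)$ denotes the set of vertices not in $S$ that are adjacent to some vertex of $S$. A simple graph $G$ is $r$-ordered if, for every sequence $v_1, \ldots, v_r$ of $r$ distinct vertices of $G$, there exists a cycle in $G$ containing $v_1, \ldots, v_r$ in this (cyclic) order. -}

module Defs where

open import Data.Nat using (ℕ; _≤_; _*_)
open import Data.Bool using (Bool; true; false; not; _∧_; _≟_)
open import Data.Fin using (Fin)
open import Data.Fin.Subset using (Subset)
open import Data.List using (List; []; _∷_; _++_; [_]; length; drop; take)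
open import Data.List.Relation.Unary.Unique.Propositional using (Unique)
open import Data.List.Relation.Binary.Sublist.Propositional using (_⊆_)
open import Data.Vec using (tabulate; toList; lookup; allFin)
open import Data.List.Relation.Unary.Any using () renaming (any? to anyL?)
open import Data.Unit using (⊤)
open import Data.Product using (_×_; ∃; ∃-syntax)
open import Relation.Binary.PropositionalEquality using (_≡_)
open import Relation.Nullary.Decidable using (⌊_⌋)

record Graph (n : ℕ) : Set where
  field
    adj    : Fin n → Fin n → Bool
    sym    : ∀ u v → adj u v ≡ adj v u
    irrefl : ∀ v → adj v v ≡ false
open Graph public

Chain : ∀ {n} → Graph n → List (Fin n) → Set
Chain G []           = ⊤
Chain G (x ∷ [])     = ⊤
Chain G (x ∷ y ∷ zs) = adj G x y ≡ true × Chain G (y ∷ zs)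

-- a cycle, listed as its distinct vertices x, x2, ..., xm (m ≥ 3),
-- with consecutive vertices adjacent and xm adjacent to x
IsCycle : ∀ {n} → Graph n → List (Fin n) → Set
IsCycle G []       = Data.Empty.⊥ where import Data.Empty
IsCycle G (x ∷ xs) = 2 ≤ length xs × Unique (x ∷ xs) × Chain G (x ∷ xs ++ [ x ])

rotate : ∀ {A : Set} → ℕ → List A → List A
rotate j c = drop j c ++ take j c

ContainsInCyclicOrder : ∀ {n} → List (Fin n) → List (Fin n) → Set
ContainsInCyclicOrder vs c = ∃[ j ] (vs ⊆ rotate j c)

Ordered : ∀ {n} → Graph n → ℕ → Set
Ordered {n} G r = (vs : List (Fin n)) → length vs ≡ r → Unique vs →
  ∃[ c ] (IsCycle G c × ContainsInCyclicOrder vs c)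

N : ∀ {n} → Graph n → Subset n → Subset n
N {n} G S = tabulate λ v →
  not (lookup S v) ∧ ⌊ anyL? (λ u → lookup S u ∧ adj G u v ≟ true) (toList (allFin n)) ⌋

{-# OPTIONS --safe #-}
module Submission where

-- Let C be the set of vertices outside S ∪ N(S), where S = V₁.  Adjacent vertices outside N(S)
-- are either both in S or both outside S, so along any walk membership in S can only change
-- across a vertex of N(S).  Choose a₁, …, a_s in S and c₁, …, c_s in C, and pad them with other
-- vertices to 2k distinct vertices.  A cycle through all of them in the cyclic order
-- a₁ c₁ a₂ c₂ … a_s c_s switches between S and C 2s times, so it passes through at least 2s
-- vertices of N(S).  These are all distinct because the cycle is simple, so |N(S)| ≥ 2s.

open import Data.Bool using (Bool; true; false; not; _∧_; _xor_; if_then_else_)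
open import Data.Bool.Properties using (¬-not)
open import Data.Fin using (Fin; zero; suc; _≟_)
open import Data.Fin.Properties using (<⇒≢; pigeonhole; ¬∀⟶∃¬)
import Data.Fin.Properties as Fin
open import Data.Fin.Subset using (Subset; inside; outside; ∣_∣; _∈_; _∉_; _-_; ∁; _∪_)
open import Data.Fin.Subset.Properties
  using (_∈?_; x∈p∧x≢y⇒x∈p-y; x∈p⇒∣p-x∣<∣p∣; x∈∁p⇒x∉p; p⊆p∪q; q⊆p∪q)
open import Data.List using (List; []; _∷_; _++_; [_]; length; lookup; map; filter; take; drop)
open import Data.List.Properties
  using ( filter-all; filter-reject; length-map; length-take; length-++-comm
        ; ++-assoc; ++-identityʳ; take++drop≡id)
open import Data.List.Membership.Propositional using (lose) renaming (_∈_ to _∈ₗ_; _∉_ to _∉ₗ_)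
open import Data.List.Relation.Binary.Permutation.Propositional
  using (_↭_; ↭-refl; ↭-prep; ↭-trans; ↭-sym; ↭⇒↭ₛ)
open import Data.List.Relation.Binary.Permutation.Propositional.Properties using (++-comm; shift)
import Data.List.Relation.Binary.Permutation.Setoid.Properties as Permutationₛ
open import Data.List.Relation.Binary.Sublist.Propositional using (_⊆_; []; _∷_; _∷ʳ_; ⊆-refl; ⊆-trans)
import Data.List.Relation.Binary.Sublist.Propositional.Properties as Sublist
open import Data.List.Relation.Unary.All using (All; []; _∷_)
import Data.List.Relation.Unary.All as All
import Data.List.Relation.Unary.All.Properties as All
open import Data.List.Relation.Unary.AllPairs using ([]; _∷_)
open import Data.List.Relation.Unary.Any using (index; any?)
open import Data.List.Relation.Unary.Any.Properties using (lookup-index)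
open import Data.List.Relation.Unary.Linked using (Linked; []; [-]; _∷_; tail)
import Data.List.Relation.Unary.Linked.Properties as Linked
open import Data.List.Relation.Unary.Unique.Propositional using (Unique)
import Data.List.Relation.Unary.Unique.Propositional.Properties as Unique
open import Data.Nat using (ℕ; zero; suc; _+_; _*_; _∸_; _≤_; _<_; z≤n; s≤s; z<s)
open import Data.Nat.Properties
  using ( ≤-trans; ≤-refl; ≤-reflexive; m≤n+m; n≤1+n; +-monoˡ-≤; +-monoʳ-≤; *-monoʳ-≤; +-assoc; +-suc
        ; +-identityʳ; *-suc; m<m+n; suc-injective; m+[n∸m]≡n; m≤n⇒m⊓n≡m; <⇒≱; module ≤-Reasoning)
open import Data.Product using (Σ; ∃; ∃₂; ∃-syntax; _×_; _,_; proj₁; proj₂)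
open import Data.Vec using ([]; _∷_; here; there)
import Data.Vec as Vec
open import Data.Vec.Membership.Propositional.Properties using (∈-toList⁺; ∈-allFin⁺)
open import Data.Vec.Properties using (lookup∘tabulate; []=⇒lookup; lookup⇒[]=)
open import Function using (_∘_; _on_)
open import Level using (_⊔_; 0ℓ)
open import Relation.Binary using (Rel)
open import Relation.Binary.PropositionalEquality
  using (_≡_; _≢_; refl; sym; trans; cong; cong₂; subst; setoid; module ≡-Reasoning)
open import Relation.Nullary using (¬_; contradiction; yes; no; ¬?; does)
open import Relation.Nullary.Decidable using (dec-true; dec-false; isYes≗does)
open import Relation.Unary using (Pred; Decidable)

open import Defs using (Graph; adj; Chain; IsCycle; rotate; ContainsInCyclicOrder; Ordered; N)

bit : Bool → ℕ
bit b = if b then 1 else 0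

changes : List Bool → ℕ
changes (x ∷ y ∷ bs) = bit (x xor y) + changes (y ∷ bs)
changes _            = 0

false≢true : ∀ {x y} → x ≡ false → y ≡ true → x ≢ y
false≢true refl refl ()

xor-triangle : ∀ x y z → bit (x xor z) ≤ bit (x xor y) + bit (y xor z)
xor-triangle false false z     = ≤-refl
xor-triangle false true  false = z≤n
xor-triangle false true  true  = s≤s z≤n
xor-triangle true  false false = ≤-refl
xor-triangle true  false true  = z≤n
xor-triangle true  true  z     = ≤-refl

changes-∷-≤-suc : ∀ x bs → changes (x ∷ bs) ≤ suc (changes bs)
changes-∷-≤-suc x []       = z≤n
changes-∷-≤-suc x (y ∷ bs) = +-monoˡ-≤ (changes (y ∷ bs)) (bit≤1 (x xor y))
  where
  bit≤1 : ∀ b → bit b ≤ 1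
  bit≤1 false = z≤n
  bit≤1 true  = s≤s z≤n

changes-≤-∷ : ∀ x bs → changes bs ≤ changes (x ∷ bs)
changes-≤-∷ x []       = z≤n
changes-≤-∷ x (y ∷ bs) = m≤n+m (changes (y ∷ bs)) (bit (x xor y))

changes-stutter : ∀ {x y} bs → x ≡ y → changes (x ∷ y ∷ bs) ≡ changes (y ∷ bs)
changes-stutter {y = false} bs refl = refl
changes-stutter {y = true}  bs refl = refl

changes-detour : ∀ x y bs → changes (x ∷ bs) ≤ bit (x xor y) + changes (y ∷ bs)
changes-detour x y []       = z≤n
changes-detour x y (z ∷ bs) = ≤-trans
  (+-monoˡ-≤ (changes (z ∷ bs)) (xor-triangle x y z))
  (≤-reflexive (+-assoc (bit (x xor y)) (bit (y xor z)) (changes (z ∷ bs))))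

changes-mono-∷ : ∀ x {bs cs} → bs ⊆ cs → changes (x ∷ bs) ≤ changes (x ∷ cs)
changes-mono-∷ x []                         = ≤-refl
changes-mono-∷ x (_∷ʳ_ {ys = cs} y bs⊆cs)   = ≤-trans (changes-mono-∷ x bs⊆cs) (changes-detour x y cs)
changes-mono-∷ x (_∷_ {x = y} refl bs⊆cs)   = +-monoʳ-≤ (bit (x xor y)) (changes-mono-∷ y bs⊆cs)

changes-mono : ∀ {bs cs} → bs ⊆ cs → changes bs ≤ changes cs
changes-mono []                       = ≤-refl
changes-mono (_∷ʳ_ {ys = cs} y bs⊆cs) = ≤-trans (changes-mono bs⊆cs) (changes-≤-∷ y cs)
changes-mono (refl ∷ bs⊆cs)           = changes-mono-∷ _ bs⊆cs

changes-alternating : ∀ {x bs} → Linked _≢_ (x ∷ bs) → changes (x ∷ bs) ≡ length bs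
changes-alternating [-]                        = refl
changes-alternating {x} {y ∷ bs} (x≢y ∷ alternating) =
  cong₂ _+_ (bit-≢ x≢y) (changes-alternating alternating)
  where
  bit-≢ : ∀ {x y} → x ≢ y → bit (x xor y) ≡ 1
  bit-≢ {false} {false} x≢y = contradiction refl x≢y
  bit-≢ {false} {true}  _   = refl
  bit-≢ {true}  {false} _   = refl
  bit-≢ {true}  {true}  x≢y = contradiction refl x≢y

module _ {a} {A : Set a} where

  Unique-resp-↭ : ∀ {xs ys : List A} → xs ↭ ys → Unique xs → Unique ys
  Unique-resp-↭ = Permutationₛ.Unique-resp-↭ (setoid A) ∘ ↭⇒↭ₛ

  Unique-++-comm : ∀ xs ys → Unique (xs ++ ys) → Unique (ys ++ xs)
  Unique-++-comm xs ys = Unique-resp-↭ (++-comm xs ys)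

  ⊆-split : ∀ {x xs zs} → (x ∷ xs) ⊆ zs → ∃₂ λ (u v : List A) → zs ≡ u ++ x ∷ v × xs ⊆ v
  ⊆-split (z ∷ʳ x∷xs⊆zs) with ⊆-split x∷xs⊆zs
  ... | u , v , refl , xs⊆v = z ∷ u , v , refl , xs⊆v
  ⊆-split (refl ∷ xs⊆zs) = [] , _ , refl , xs⊆zs

  alternate : List A → List A → List A
  alternate (x ∷ xs) (y ∷ ys) = x ∷ y ∷ alternate xs ys
  alternate _        _        = []

  length-alternate : ∀ xs ys → length xs ≡ length ys → length (alternate xs ys) ≡ 2 * length xs
  length-alternate []       []       refl      = refl
  length-alternate (x ∷ xs) (y ∷ ys) |xs|≡|ys| =
    trans (cong (2 +_) (length-alternate xs ys (suc-injective |xs|≡|ys|))) (sym (*-suc 2 (length xs)))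

  alternate-↭ : ∀ xs ys → length xs ≡ length ys → alternate xs ys ↭ xs ++ ys
  alternate-↭ []       []       refl      = ↭-refl
  alternate-↭ (x ∷ xs) (y ∷ ys) |xs|≡|ys| =
    ↭-prep x (↭-trans (↭-prep y (alternate-↭ xs ys (suc-injective |xs|≡|ys|))) (↭-sym (shift y xs ys)))

  All-alternate : ∀ {p} {P : Pred A p} {xs ys} → All P xs → All P ys → All P (alternate xs ys)
  All-alternate (px ∷ pxs) (py ∷ pys) = px ∷ py ∷ All-alternate pxs pys
  All-alternate []         _          = []
  All-alternate (_ ∷ _)    []         = []

  alternate-++-alternating : ∀ (f : A → Bool) {xs ys x z} →
    All ((_≡ true) ∘ f) xs → All ((_≡ false) ∘ f) ys → f x ≡ false → f z ≡ true →
    Linked (_≢_ on f) (x ∷ alternate xs ys ++ [ z ])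
  alternate-++-alternating f []          _          fx fz = false≢true fx fz ∷ [-]
  alternate-++-alternating f (_ ∷ _)     []         fx fz = false≢true fx fz ∷ [-]
  alternate-++-alternating f (fx′ ∷ fxs) (fy ∷ fys) fx fz =
    false≢true fx fx′ ∷ false≢true fy fx′ ∘ sym ∷ alternate-++-alternating f fxs fys fy fz

module _ {a ℓ} {A : Set a} {R : Rel A ℓ} where

  Linked-split : ∀ xs {y ys} → Linked R (xs ++ y ∷ ys) → Linked R (xs ++ [ y ]) × Linked R (y ∷ ys)
  Linked-split []            walk          = [-] , walk
  Linked-split (x ∷ [])      (Rxy ∷ walk)  = Rxy ∷ [-] , walk
  Linked-split (x ∷ x′ ∷ xs) (Rxx′ ∷ walk) with Linked-split (x′ ∷ xs) walk
  ... | front , back = Rxx′ ∷ front , back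

  Linked-join : ∀ xs {y ys} → Linked R (xs ++ [ y ]) → Linked R (y ∷ ys) → Linked R (xs ++ y ∷ ys)
  Linked-join []            _              back = back
  Linked-join (x ∷ [])      (Rxy ∷ [-])    back = Rxy ∷ back
  Linked-join (x ∷ x′ ∷ xs) (Rxx′ ∷ front) back = Rxx′ ∷ Linked-join (x′ ∷ xs) front back

-- A closed walk is listed without repeating its first vertex, as the cycles of `IsCycle` are.
Closed : ∀ {a ℓ} {A : Set a} → Rel A ℓ → List A → Set (a ⊔ ℓ)
Closed R xs = Linked R (xs ++ take 1 xs)

module _ {a ℓ} {A : Set a} {R : Rel A ℓ} where

  Closed-++-comm : ∀ xs ys → Closed R (xs ++ ys) → Closed R (ys ++ xs)
  Closed-++-comm []       ys       closed = subst (Closed R) (sym (++-identityʳ ys)) closed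
  Closed-++-comm (x ∷ xs) []       closed = subst (Closed R) (++-identityʳ (x ∷ xs)) closed
  Closed-++-comm (x ∷ xs) (y ∷ ys) closed
    with Linked-split (x ∷ xs) (subst (Linked R) (++-assoc (x ∷ xs) (y ∷ ys) [ x ]) closed)
  ... | x⋯y , y⋯x =
    subst (Linked R) (sym (++-assoc (y ∷ ys) (x ∷ xs) [ y ])) (Linked-join (y ∷ ys) y⋯x x⋯y)

  closed-walk-from : ∀ {zs x xs} → Closed R zs → Unique zs → (x ∷ xs) ⊆ zs →
    ∃ λ w → Closed R (x ∷ w) × Unique (x ∷ w) × xs ⊆ w
  closed-walk-from closed unique x∷xs⊆zs with ⊆-split x∷xs⊆zs
  ... | u , v , refl , xs⊆v =
    v ++ u , Closed-++-comm u (_ ∷ v) closed , Unique-++-comm u (_ ∷ v) unique , Sublist.++⁺ʳ u xs⊆v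

module _ {A : Set} where

  Unique-rotate : ∀ j {c : List A} → Unique c → Unique (rotate j c)
  Unique-rotate j {c} unique =
    Unique-++-comm (take j c) (drop j c) (subst Unique (sym (take++drop≡id j c)) unique)

  Closed-rotate : ∀ {ℓ} {R : Rel A ℓ} j {c} → Closed R c → Closed R (rotate j c)
  Closed-rotate {R = R} j {c} closed =
    Closed-++-comm (take j c) (drop j c) (subst (Closed R) (sym (take++drop≡id j c)) closed)

module Separation {a ℓ p} {A : Set a} (E : Rel A ℓ) {B : Pred A p} (B? : Decidable B)
  (colour : A → Bool) (separated : ∀ {x y} → E x y → ¬ B x → ¬ B y → colour x ≡ colour y)
  where

  colours : List A → List Bool
  colours xs = map colour (filter (¬? ∘ B?) xs)

  boundaryCount : List A → ℕ
  boundaryCount xs = length (filter B? xs)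

  changes≤boundaryCount : ∀ xs → Linked E xs → changes (colours xs) ≤ boundaryCount xs
  changes-from≤boundaryCount : ∀ x xs → ¬ B x → Linked E (x ∷ xs) →
    changes (colour x ∷ colours xs) ≤ boundaryCount xs

  changes≤boundaryCount []       _    = z≤n
  changes≤boundaryCount (x ∷ xs) walk with B? x
  ... | yes _  = ≤-trans (changes≤boundaryCount xs (tail walk)) (n≤1+n _)
  ... | no ¬Bx = changes-from≤boundaryCount x xs ¬Bx walk

  changes-from≤boundaryCount x []       _   _            = z≤n
  changes-from≤boundaryCount x (y ∷ xs) ¬Bx (Exy ∷ walk) with B? y
  ... | yes _  = ≤-trans (changes-∷-≤-suc (colour x) (colours xs))
                         (s≤s (changes≤boundaryCount xs (tail walk)))
  ... | no ¬By = ≤-trans (≤-reflexive (changes-stutter (colours xs) (separated Exy ¬Bx ¬By)))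
                         (changes-from≤boundaryCount y xs ¬By walk)

  alternating-visits≤boundaryCount : ∀ {ws y ys} → Linked E ws → (y ∷ ys) ⊆ ws →
    All (¬_ ∘ B) (y ∷ ys) → Linked (_≢_ on colour) (y ∷ ys) → length ys ≤ boundaryCount ws
  alternating-visits≤boundaryCount {ws} {y} {ys} walk visits away alternating = begin
    length ys                      ≡⟨ sym (length-map colour ys) ⟩
    length (map colour ys)         ≡⟨ sym (changes-alternating (Linked.map⁺ alternating)) ⟩
    changes (map colour (y ∷ ys))  ≤⟨ changes-mono (Sublist.map⁺ colour visits-away) ⟩
    changes (colours ws)           ≤⟨ changes≤boundaryCount ws walk ⟩
    boundaryCount ws               ∎
    where
    open ≤-Reasoning
    visits-away : (y ∷ ys) ⊆ filter (¬? ∘ B?) ws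
    visits-away = subst (_⊆ filter (¬? ∘ B?) ws) (filter-all (¬? ∘ B?) away)
                    (Sublist.filter⁺ (¬? ∘ B?) (¬? ∘ B?) (λ { refl ¬Bx → ¬Bx }) visits)

module _ {n : ℕ} where

  length≤∣p∣ : ∀ {p : Subset n} {xs} → Unique xs → All (_∈ p) xs → length xs ≤ ∣ p ∣
  length≤∣p∣              []              []           = z≤n
  length≤∣p∣ {p} {x ∷ xs} (x∉xs ∷ unique) (x∈p ∷ xs⊆p) = begin-strict
    length xs  ≤⟨ length≤∣p∣ unique xs⊆p-x ⟩
    ∣ p - x ∣  <⟨ x∈p⇒∣p-x∣<∣p∣ x∈p ⟩
    ∣ p ∣      ∎
    where
    open ≤-Reasoning
    xs⊆p-x : All (_∈ p - x) xs
    xs⊆p-x = All.zipWith (λ (y∈p , x≢y) → x∈p∧x≢y⇒x∈p-y y∈p (x≢y ∘ sym)) (xs⊆p , x∉xs)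

  length-filter-∈≤∣p∣ : ∀ (p : Subset n) {xs} → Unique xs → length (filter (_∈? p) xs) ≤ ∣ p ∣
  length-filter-∈≤∣p∣ p {xs} unique =
    length≤∣p∣ (Unique.filter⁺ (_∈? p) unique) (All.all-filter (_∈? p) xs)

  length<n⇒∃∉ : (xs : List (Fin n)) → length xs < n → ∃ λ v → v ∉ₗ xs
  length<n⇒∃∉ xs |xs|<n = ¬∀⟶∃¬ n (_∈ₗ xs) (λ v → any? (v ≟_) xs) covering-impossible
    where
    covering-impossible : ¬ (∀ v → v ∈ₗ xs)
    covering-impossible covered with pigeonhole |xs|<n (index ∘ covered)
    ... | i , j , i<j , same-index = <⇒≢ i<j (begin
      i                              ≡⟨ lookup-index (covered i) ⟩
      lookup xs (index (covered i))  ≡⟨ cong (lookup xs) same-index ⟩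
      lookup xs (index (covered j))  ≡⟨ sym (lookup-index (covered j)) ⟩
      j                              ∎)
      where open ≡-Reasoning

  extend-Unique : ∀ d {xs : List (Fin n)} → Unique xs → length xs + d ≤ n →
    ∃ λ ys → Unique ys × xs ⊆ ys × length ys ≡ length xs + d
  extend-Unique zero    {xs} unique _ = xs , unique , ⊆-refl , sym (+-identityʳ (length xs))
  extend-Unique (suc d) {xs} unique fits
    with length<n⇒∃∉ xs (≤-trans (m<m+n (length xs) z<s) fits)
  ... | v , v∉xs
    with extend-Unique d (All.¬Any⇒All¬ xs v∉xs ∷ unique)
                         (≤-trans (≤-reflexive (sym (+-suc (length xs) d))) fits)
  ... | ys , uniqueʸ , v∷xs⊆ys , |ys| =
    ys , uniqueʸ , ⊆-trans (v ∷ʳ ⊆-refl) v∷xs⊆ys , trans |ys| (sym (+-suc (length xs) d))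

elements : ∀ {n} → Subset n → List (Fin n)
elements []            = []
elements (inside ∷ p)  = zero ∷ map suc (elements p)
elements (outside ∷ p) = map suc (elements p)

length-elements : ∀ {n} (p : Subset n) → length (elements p) ≡ ∣ p ∣
length-elements []            = refl
length-elements (inside ∷ p)  = cong suc (trans (length-map suc (elements p)) (length-elements p))
length-elements (outside ∷ p) = trans (length-map suc (elements p)) (length-elements p)

elements-∈ : ∀ {n} (p : Subset n) → All (_∈ p) (elements p)
elements-∈ []            = []
elements-∈ (inside ∷ p)  = here ∷ All.map⁺ (All.map there (elements-∈ p))
elements-∈ (outside ∷ p) = All.map⁺ (All.map there (elements-∈ p))

elements-Unique : ∀ {n} (p : Subset n) → Unique (elements p)
elements-Unique []            = []
elements-Unique (inside ∷ p)  =
  All.map⁺ (All.tabulate (λ _ ())) ∷ Unique.map⁺ Fin.suc-injective (elements-Unique p)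
elements-Unique (outside ∷ p) = Unique.map⁺ Fin.suc-injective (elements-Unique p)

x∈∁[p∪q]⇒x∉p×x∉q : ∀ {n} {x : Fin n} (p q : Subset n) → x ∈ ∁ (p ∪ q) → x ∉ p × x ∉ q
x∈∁[p∪q]⇒x∉p×x∉q p q x∈∁[p∪q] = x∉p∪q ∘ p⊆p∪q q , x∉p∪q ∘ q⊆p∪q p q
  where x∉p∪q = x∈∁p⇒x∉p x∈∁[p∪q]

Adjacent : ∀ {n} → Graph n → Rel (Fin n) 0ℓ
Adjacent G x y = adj G x y ≡ true

Chain⇒Linked : ∀ {n} {G : Graph n} xs → Chain G xs → Linked (Adjacent G) xs
Chain⇒Linked []           _            = []
Chain⇒Linked (x ∷ [])     _            = [-]
Chain⇒Linked (x ∷ y ∷ xs) (xy , chain) = xy ∷ Chain⇒Linked (y ∷ xs) chain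

Ordered-anti-mono : ∀ {n} {G : Graph n} {r r′} → r ≤ n → r′ ≤ r → Ordered G r → Ordered G r′
Ordered-anti-mono {r = r} r≤n r′≤r ordered vs refl unique
  with extend-Unique (r ∸ length vs) unique (subst (_≤ _) (sym (m+[n∸m]≡n r′≤r)) r≤n)
... | ys , uniqueʸ , vs⊆ys , |ys|
  with ordered ys (trans |ys| (m+[n∸m]≡n r′≤r)) uniqueʸ
... | c , cycle , j , ys⊆c = c , cycle , j , ⊆-trans vs⊆ys ys⊆c

module Neighbourhood {n} (G : Graph n) (S : Subset n) where

  ∈⇒∉N : ∀ {x} → x ∈ S → x ∉ N G S
  ∈⇒∉N {x} x∈S x∈N
    with Vec.lookup S x | []=⇒lookup x∈S | trans (sym ([]=⇒lookup x∈N)) (lookup∘tabulate _ x)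
  ... | .true | refl | ()

  adjacent-∉⇒∈N : ∀ {u v} → Adjacent G u v → u ∈ S → v ∉ S → v ∈ N G S
  adjacent-∉⇒∈N {u} {v} uv u∈S v∉S = lookup⇒[]= v (N G S) (trans (lookup∘tabulate _ v)
    (cong₂ (λ b c → not b ∧ c) (¬-not (v∉S ∘ lookup⇒[]= v S))
      (trans (isYes≗does _) (dec-true (any? _ _)
        (lose (∈-toList⁺ (∈-allFin⁺ u)) (cong₂ _∧_ ([]=⇒lookup u∈S) uv))))))

  colour : Fin n → Bool
  colour v = does (v ∈? S)

  separated : ∀ {x y} → Adjacent G x y → x ∉ N G S → y ∉ N G S → colour x ≡ colour y
  separated {x} {y} xy x∉N y∉N with x ∈? S | y ∈? S
  ... | yes _   | yes _   = refl
  ... | no  _   | no  _   = refl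
  ... | yes x∈S | no  y∉S = contradiction (adjacent-∉⇒∈N xy x∈S y∉S) y∉N
  ... | no  x∉S | yes y∈S = contradiction (adjacent-∉⇒∈N (trans (Graph.sym G y x) xy) y∈S x∉S) x∉N

  open Separation (Adjacent G) (_∈? N G S) colour separated

  -- Rotating the cycle to start at y turns the cyclic visits y ys into the linear walk y ⋯ y.
  cycle-alternations≤∣N∣ : ∀ {y ys} → ∃[ c ] (IsCycle G c × ContainsInCyclicOrder (y ∷ ys) c) →
    All (_∉ N G S) (y ∷ ys) → Linked (_≢_ on colour) (y ∷ ys ++ [ y ]) → length (y ∷ ys) ≤ ∣ N G S ∣
  cycle-alternations≤∣N∣ {y} {ys} (h ∷ t , (_ , unique , chain) , j , visits) away@(y∉N ∷ _) alternating
    with closed-walk-from (Closed-rotate j (Chain⇒Linked (h ∷ t ++ [ h ]) chain))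
                          (Unique-rotate j unique) visits
  ... | w , closed , uniqueʷ , ys⊆w = begin
    length (y ∷ ys)                 ≡⟨ length-++-comm [ y ] ys ⟩
    length (ys ++ [ y ])            ≤⟨ alternating-visits≤boundaryCount closed
                                         (refl ∷ Sublist.++⁺ ys⊆w ⊆-refl)
                                         (All.++⁺ away (y∉N ∷ [])) alternating ⟩
    boundaryCount (y ∷ w ++ [ y ])  ≡⟨ cong length (filter-reject (_∈? N G S) y∉N) ⟩
    boundaryCount (w ++ [ y ])      ≤⟨ length-filter-∈≤∣p∣ (N G S) (Unique-++-comm [ y ] w uniqueʷ) ⟩
    ∣ N G S ∣                       ∎
    where open ≤-Reasoning

  alternating-cycle≤∣N∣ : ∀ {as cs} → All (_∈ S) as → All (_∈ ∁ (N G S ∪ S)) cs →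
    ∃[ c ] (IsCycle G c × ContainsInCyclicOrder (alternate as cs) c) →
    length (alternate as cs) ≤ ∣ N G S ∣
  alternating-cycle≤∣N∣ {[]}              _    _    _     = z≤n
  alternating-cycle≤∣N∣ {_ ∷ _} {[]}      _    _    _     = z≤n
  alternating-cycle≤∣N∣ {a ∷ as} {c ∷ cs} as⊆S cs⊆C cycle =
    cycle-alternations≤∣N∣ cycle
      (All-alternate (All.map ∈⇒∉N as⊆S) (All.map (proj₁ ∘ ∉N×∉S) cs⊆C))
      (false≢true c-colour a-colour ∘ sym ∷
       alternate-++-alternating colour (All.map inside-colour (All.tail as⊆S))
         (All.map outside-colour (All.tail cs⊆C)) c-colour a-colour)
    where
    ∉N×∉S : ∀ {x} → x ∈ ∁ (N G S ∪ S) → x ∉ N G S × x ∉ S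
    ∉N×∉S = x∈∁[p∪q]⇒x∉p×x∉q (N G S) S
    inside-colour : ∀ {x} → x ∈ S → colour x ≡ true
    inside-colour {x} = dec-true (x ∈? S)
    outside-colour : ∀ {x} → x ∈ ∁ (N G S ∪ S) → colour x ≡ false
    outside-colour {x} = dec-false (x ∈? S) ∘ proj₂ ∘ ∉N×∉S
    a-colour = inside-colour (All.head as⊆S)
    c-colour = outside-colour (All.head cs⊆C)

lemma4p1 : (k n : ℕ) (G : Graph n) → 1 ≤ k → Ordered G (2 * k) → 2 * k ≤ n →
    (s : ℕ) → 1 ≤ s → s ≤ k →
    ¬ (Σ (Subset n) λ V₁ → ∣ V₁ ∣ ≡ s × s ≤ ∣ ∁ (N G V₁ ∪ V₁) ∣ × ∣ N G V₁ ∣ < 2 * s)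
lemma4p1 k n G _ ordered 2k≤n s _ s≤k (V₁ , ∣V₁∣≡s , s≤∣C∣ , ∣N∣<2s) = <⇒≱ ∣N∣<2s (begin
  2 * s       ≡⟨ sym ∣I∣≡2s ⟩
  length I    ≤⟨ Neighbourhood.alternating-cycle≤∣N∣ G V₁ (elements-∈ V₁) cs⊆C
                   (Ordered-anti-mono 2k≤n (*-monoʳ-≤ 2 s≤k) ordered I ∣I∣≡2s unique) ⟩
  ∣ N G V₁ ∣  ∎)
  where
  open ≤-Reasoning
  C  = ∁ (N G V₁ ∪ V₁)
  as = elements V₁
  cs = take s (elements C)
  I  = alternate as cs

  cs⊆C : All (_∈ C) cs
  cs⊆C = Sublist.All-resp-⊆ (Sublist.take-⊆ s (elements C)) (elements-∈ C)

  ∣as∣≡s : length as ≡ s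
  ∣as∣≡s = trans (length-elements V₁) ∣V₁∣≡s

  ∣cs∣≡s : length cs ≡ s
  ∣cs∣≡s = trans (length-take s (elements C))
                 (m≤n⇒m⊓n≡m (subst (s ≤_) (sym (length-elements C)) s≤∣C∣))

  ∣as∣≡∣cs∣ : length as ≡ length cs
  ∣as∣≡∣cs∣ = trans ∣as∣≡s (sym ∣cs∣≡s)

  ∣I∣≡2s : length I ≡ 2 * s
  ∣I∣≡2s = trans (length-alternate as cs ∣as∣≡∣cs∣) (cong (2 *_) ∣as∣≡s)

  unique : Unique I
  unique = Unique-resp-↭ (↭-sym (alternate-↭ as cs ∣as∣≡∣cs∣))
    (Unique.++⁺ (elements-Unique V₁) (Unique.take⁺ s (elements-Unique C)) λ (v∈as , v∈cs) →
      proj₂ (x∈∁[p∪q]⇒x∉p×x∉q (N G V₁) V₁ (All.lookup cs⊆C v∈cs)) (All.lookup (elements-∈ V₁) v∈as))
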